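{- Work in intuitionistic set theory $\mathrm{IKP}$. Suppose $\mathcal{O}_1,\mathcal{O}_2\subseteq\mathrm{Ord}$ are classes each of which is a "class of plump ordinals", meaning that for $\mathcal{O}\in\{\mathcal{O}_1,\mathcal{O}_2\}$ and every $\alpha\in\mathrm{Ord}$: $\alpha\in\mathcal{O}$ if and only if (i) $\alpha\subseteq\mathcal{O}$ and (ii) for every $\beta\in\alpha$, every $\gamma\subseteq\beta$ with $\gamma\in\mathcal{O}$ satisfies $\gamma\in\alpha$. Then $\mathcal{O}_1=\mathcal{O}_2$.
   Context: $\mathrm{IKP}$ is intuitionistic Kripke–Platek set theory with strong infinity: over intuitionistic logic, the axioms of extensionality, empty set, pairing, union, $\Delta_0$-separation, $\Delta_0$-collection, the set induction scheme, and existence of $\omega$. $\mathrm{Ord}$ is the class of transitive sets all of whose elements are transitive. -}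

module Defs where

open import Level using (Level; suc; _⊔_)
open import Data.Nat using (ℕ) renaming (suc to sucℕ)
open import Data.Fin using (Fin)
open import Data.Vec.Functional using (_∷_)
open import Data.Product using (Σ; _×_; ∃)
open import Data.Sum using (_⊎_)
open import Data.Empty.Polymorphic using (⊥)
open import Relation.Binary.PropositionalEquality using (_≡_)

-- First-order syntax of the language of set theory {∈, =}
-- (de Bruijn variables; n = number of free variables).
-- Bounded quantifiers are primitive so that Δ₀ formulas can be singled out.

data Formula (n : ℕ) : Set where
  _∈'_ : Fin n → Fin n → Formula n
  _≐_  : Fin n → Fin n → Formula n
  ⊥'   : Formula n
  _∧'_ : Formula n → Formula n → Formula n
  _∨'_ : Formula n → Formula n → Formula n
  _⇒'_ : Formula n → Formula n → Formula n
  ∀'   : Formula (sucℕ n) → Formula n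
  ∃'   : Formula (sucℕ n) → Formula n
  -- bounded quantifiers ∀ x ∈ v. φ  and  ∃ x ∈ v. φ   (x is the new variable 0)
  ∀∈'  : Fin n → Formula (sucℕ n) → Formula n
  ∃∈'  : Fin n → Formula (sucℕ n) → Formula n

data IsΔ₀ : {n : ℕ} → Formula n → Set where
  ∈-Δ₀ : ∀ {n} (i j : Fin n) → IsΔ₀ (i ∈' j)
  ≐-Δ₀ : ∀ {n} (i j : Fin n) → IsΔ₀ (i ≐ j)
  ⊥-Δ₀ : ∀ {n} → IsΔ₀ {n} ⊥'
  ∧-Δ₀ : ∀ {n} {φ ψ : Formula n} → IsΔ₀ φ → IsΔ₀ ψ → IsΔ₀ (φ ∧' ψ)
  ∨-Δ₀ : ∀ {n} {φ ψ : Formula n} → IsΔ₀ φ → IsΔ₀ ψ → IsΔ₀ (φ ∨' ψ)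
  ⇒-Δ₀ : ∀ {n} {φ ψ : Formula n} → IsΔ₀ φ → IsΔ₀ ψ → IsΔ₀ (φ ⇒' ψ)
  ∀∈-Δ₀ : ∀ {n} (i : Fin n) {φ : Formula (sucℕ n)} → IsΔ₀ φ → IsΔ₀ (∀∈' i φ)
  ∃∈-Δ₀ : ∀ {n} (i : Fin n) {φ : Formula (sucℕ n)} → IsΔ₀ φ → IsΔ₀ (∃∈' i φ)

module Semantics {ℓ : Level} {V : Set ℓ} (_∈_ : V → V → Set ℓ) where

  ⟦_⟧ : ∀ {n} → Formula n → (Fin n → V) → Set ℓ
  ⟦ i ∈' j ⟧ ρ = ρ i ∈ ρ j
  ⟦ i ≐ j ⟧ ρ = ρ i ≡ ρ j
  ⟦ ⊥' ⟧ ρ = ⊥ {ℓ}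
  ⟦ φ ∧' ψ ⟧ ρ = ⟦ φ ⟧ ρ × ⟦ ψ ⟧ ρ
  ⟦ φ ∨' ψ ⟧ ρ = ⟦ φ ⟧ ρ ⊎ ⟦ ψ ⟧ ρ
  ⟦ φ ⇒' ψ ⟧ ρ = ⟦ φ ⟧ ρ → ⟦ ψ ⟧ ρ
  ⟦ ∀' φ ⟧ ρ = ∀ x → ⟦ φ ⟧ (x ∷ ρ)
  ⟦ ∃' φ ⟧ ρ = Σ V λ x → ⟦ φ ⟧ (x ∷ ρ)
  ⟦ ∀∈' i φ ⟧ ρ = ∀ x → x ∈ ρ i → ⟦ φ ⟧ (x ∷ ρ)
  ⟦ ∃∈' i φ ⟧ ρ = Σ V λ x → x ∈ ρ i × ⟦ φ ⟧ (x ∷ ρ)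

  _⊆_ : V → V → Set ℓ
  a ⊆ b = ∀ x → x ∈ a → x ∈ b

  IsEmpty : V → Set ℓ
  IsEmpty e = ∀ x → x ∈ e → ⊥ {ℓ}

  IsSucc : V → V → Set ℓ
  IsSucc x s = ∀ z → (z ∈ s → z ∈ x ⊎ z ≡ x) × (z ∈ x ⊎ z ≡ x → z ∈ s)

  Inductive : V → Set ℓ
  Inductive y = (Σ V λ e → IsEmpty e × e ∈ y)
              × (∀ x → x ∈ y → Σ V λ s → IsSucc x s × s ∈ y)

  Transitive : V → Set ℓ
  Transitive a = ∀ x → x ∈ a → ∀ y → y ∈ x → y ∈ a

  IsOrd : V → Set ℓ
  IsOrd a = Transitive a × (∀ x → x ∈ a → Transitive x)

-- Models of IKP (in the sense of Agda structures with Leibniz equality);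
-- the schemes range over all (Δ₀ resp. arbitrary) formulas with parameters.

record IKP (ℓ : Level) : Set (suc ℓ) where
  field
    V   : Set ℓ
    _∈_ : V → V → Set ℓ
  open Semantics _∈_
  field
    extensionality : ∀ a b → (∀ x → (x ∈ a → x ∈ b) × (x ∈ b → x ∈ a)) → a ≡ b
    empty   : Σ V λ e → IsEmpty e
    pairing : ∀ a b → Σ V λ c → a ∈ c × b ∈ c
    union   : ∀ a → Σ V λ u → ∀ x → x ∈ a → ∀ y → y ∈ x → y ∈ u
    Δ₀-separation : ∀ {n} (φ : Formula (sucℕ n)) → IsΔ₀ φ → (ρ : Fin n → V) → ∀ a →
      Σ V λ b → ∀ x → (x ∈ b → x ∈ a × ⟦ φ ⟧ (x ∷ ρ)) × (x ∈ a × ⟦ φ ⟧ (x ∷ ρ) → x ∈ b)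
    Δ₀-collection : ∀ {n} (φ : Formula (sucℕ (sucℕ n))) → IsΔ₀ φ → (ρ : Fin n → V) → ∀ a →
      (∀ x → x ∈ a → Σ V λ y → ⟦ φ ⟧ (y ∷ x ∷ ρ)) →
      Σ V λ b → ∀ x → x ∈ a → Σ V λ y → y ∈ b × ⟦ φ ⟧ (y ∷ x ∷ ρ)
    set-induction : ∀ {n} (φ : Formula (sucℕ n)) (ρ : Fin n → V) →
      (∀ a → (∀ x → x ∈ a → ⟦ φ ⟧ (x ∷ ρ)) → ⟦ φ ⟧ (a ∷ ρ)) →
      ∀ a → ⟦ φ ⟧ (a ∷ ρ)
    strong-infinity : Σ V λ ω → Inductive ω × (∀ y → Inductive y → ω ⊆ y)
  open Semantics _∈_ public

module _ {ℓ : Level} (M : IKP ℓ) where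
  open IKP M

  record Class : Set ℓ where
    constructor class
    field
      {arity}  : ℕ
      formula  : Formula (sucℕ arity)
      params   : Fin arity → V

  _∈Cl_ : V → Class → Set ℓ
  x ∈Cl class φ ρ = ⟦ φ ⟧ (x ∷ ρ)

  IsPlumpClass : Class → Set ℓ
  IsPlumpClass 𝒪 =
    (∀ α → α ∈Cl 𝒪 → IsOrd α) ×
    (∀ α → IsOrd α →
      (α ∈Cl 𝒪 → (∀ x → x ∈ α → x ∈Cl 𝒪) ×
                  (∀ β → β ∈ α → ∀ γ → γ ⊆ β → γ ∈Cl 𝒪 → γ ∈ α)) ×
      ((∀ x → x ∈ α → x ∈Cl 𝒪) ×
       (∀ β → β ∈ α → ∀ γ → γ ⊆ β → γ ∈Cl 𝒪 → γ ∈ α) → α ∈Cl 𝒪))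

-- By ∈-induction on a, 𝒪₁ and 𝒪₂ contain the same subsets of a. If they agree on the
-- subsets of every element of a and γ ⊆ a lies in 𝒪₁, then γ meets the plumpness
-- conditions for 𝒪₂: its elements, and the members of 𝒪₂ below its elements, are
-- subsets of elements of a, so they can be moved to 𝒪₁, where the plumpness of γ
-- applies. Set induction is an axiom scheme over formulas, so this induction
-- hypothesis must be written as a single formula in the parameters of both classes.
module Submission where

open import Defs
open import Level using (Level)
open import Data.Nat using (ℕ) renaming (suc to sucℕ)
open import Data.Fin using (Fin; zero; suc; _↑ˡ_; _↑ʳ_)
open import Data.Product using (Σ; _×_; _,_; proj₁; proj₂; map₂)
open import Data.Product.Function.NonDependent.Propositional using (_×-⇔_)
open import Data.Sum.Function.Propositional using (_⊎-⇔_)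
open import Data.Vec.Functional using (_∷_; _++_)
open import Data.Vec.Functional.Properties using (lookup-++ˡ; lookup-++ʳ)
open import Function using (_∘_)
open import Function.Bundles using (_⇔_; mk⇔; Equivalence)
open import Function.Construct.Identity using (⇔-id)
open import Function.Construct.Symmetry using (⇔-sym)
open import Function.Related.TypeIsomorphisms using (→-cong-⇔)
open import Relation.Binary.PropositionalEquality using (refl; _≗_)

open Equivalence using (to; from)

private
  variable
    ℓ : Level
    n m : ℕ

lift : (Fin n → Fin m) → Fin (sucℕ n) → Fin (sucℕ m)
lift r zero    = zero
lift r (suc i) = suc (r i)

rename : (Fin n → Fin m) → Formula n → Formula m
rename r (i ∈' j)  = r i ∈' r j
rename r (i ≐ j)   = r i ≐ r j
rename r ⊥'        = ⊥'
rename r (φ ∧' ψ)  = rename r φ ∧' rename r ψ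
rename r (φ ∨' ψ)  = rename r φ ∨' rename r ψ
rename r (φ ⇒' ψ)  = rename r φ ⇒' rename r ψ
rename r (∀' φ)    = ∀' (rename (lift r) φ)
rename r (∃' φ)    = ∃' (rename (lift r) φ)
rename r (∀∈' i φ) = ∀∈' (r i) (rename (lift r) φ)
rename r (∃∈' i φ) = ∃∈' (r i) (rename (lift r) φ)

_⇔'_ : Formula n → Formula n → Formula n
φ ⇔' ψ = (φ ⇒' ψ) ∧' (ψ ⇒' φ)

_⊆'_ : Fin n → Fin n → Formula n
i ⊆' j = ∀∈' i (zero ∈' suc j)

Π-cong-⇔ : {A : Set ℓ} {P Q : A → Set ℓ} → (∀ x → P x ⇔ Q x) → (∀ x → P x) ⇔ (∀ x → Q x)
Π-cong-⇔ P⇔Q = mk⇔ (λ p x → to (P⇔Q x) (p x)) (λ q x → from (P⇔Q x) (q x))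

Σ-cong-⇔ : {A : Set ℓ} {P Q : A → Set ℓ} → (∀ x → P x ⇔ Q x) → Σ A P ⇔ Σ A Q
Σ-cong-⇔ P⇔Q = mk⇔ (map₂ (to (P⇔Q _))) (map₂ (from (P⇔Q _)))

module _ (M : IKP ℓ) where
  open IKP M

  lift-≗ : {r : Fin n → Fin m} {ρ : Fin m → V} {σ : Fin n → V} →
           ρ ∘ r ≗ σ → ∀ x → (x ∷ ρ) ∘ lift r ≗ x ∷ σ
  lift-≗ ρ∘r≗σ x zero    = refl
  lift-≗ ρ∘r≗σ x (suc i) = ρ∘r≗σ i

  ⟦rename⟧ : (r : Fin n → Fin m) (φ : Formula n) {ρ : Fin m → V} {σ : Fin n → V} →
             ρ ∘ r ≗ σ → ⟦ rename r φ ⟧ ρ ⇔ ⟦ φ ⟧ σ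
  ⟦rename⟧ r (i ∈' j) h rewrite h i | h j = ⇔-id _
  ⟦rename⟧ r (i ≐ j)  h rewrite h i | h j = ⇔-id _
  ⟦rename⟧ r ⊥'       h = ⇔-id _
  ⟦rename⟧ r (φ ∧' ψ) h = ⟦rename⟧ r φ h ×-⇔ ⟦rename⟧ r ψ h
  ⟦rename⟧ r (φ ∨' ψ) h = ⟦rename⟧ r φ h ⊎-⇔ ⟦rename⟧ r ψ h
  ⟦rename⟧ r (φ ⇒' ψ) h = →-cong-⇔ (⟦rename⟧ r φ h) (⟦rename⟧ r ψ h)
  ⟦rename⟧ r (∀' φ)   h = Π-cong-⇔ λ x → ⟦rename⟧ (lift r) φ (lift-≗ h x)
  ⟦rename⟧ r (∃' φ)   h = Σ-cong-⇔ λ x → ⟦rename⟧ (lift r) φ (lift-≗ h x)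
  ⟦rename⟧ r (∀∈' i φ) h rewrite h i =
    Π-cong-⇔ λ x → →-cong-⇔ (⇔-id _) (⟦rename⟧ (lift r) φ (lift-≗ h x))
  ⟦rename⟧ r (∃∈' i φ) h rewrite h i =
    Σ-cong-⇔ λ x → ⇔-id _ ×-⇔ ⟦rename⟧ (lift r) φ (lift-≗ h x)

  ⟦⇔'⟧ : (φ ψ : Formula n) {ρ : Fin n → V} {A B : Set ℓ} →
         ⟦ φ ⟧ ρ ⇔ A → ⟦ ψ ⟧ ρ ⇔ B → ⟦ φ ⇔' ψ ⟧ ρ ⇔ (A ⇔ B)
  ⟦⇔'⟧ φ ψ φ⇔A ψ⇔B = mk⇔
    (λ (f , g) → mk⇔ (to ψ⇔B ∘ f ∘ from φ⇔A) (to φ⇔A ∘ g ∘ from ψ⇔B))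
    (λ A⇔B → from ψ⇔B ∘ to A⇔B ∘ to φ⇔A , from φ⇔A ∘ from A⇔B ∘ to ψ⇔B)

  _∈ᶜ_ : V → Class M → Set ℓ
  _∈ᶜ_ = _∈Cl_ M

  definable-induction : {P : V → Set ℓ} (C : Class M) → (∀ a → P a ⇔ a ∈ᶜ C) →
                        (∀ a → (∀ x → x ∈ a → P x) → P a) → ∀ a → P a
  definable-induction (class φ ρ) P⇔C step a =
    from (P⇔C a) (set-induction φ ρ step′ a)
    where
      step′ : ∀ b → (∀ x → x ∈ b → ⟦ φ ⟧ (x ∷ ρ)) → ⟦ φ ⟧ (b ∷ ρ)
      step′ b ih = to (P⇔C b) (step b (λ x x∈b → from (P⇔C x) (ih x x∈b)))

  AgreeOnSubsets : Class M → Class M → V → Set ℓ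
  AgreeOnSubsets 𝒪₁ 𝒪₂ a = ∀ γ → γ ⊆ a → (γ ∈ᶜ 𝒪₁ ⇔ γ ∈ᶜ 𝒪₂)

  -- Variables: 0 is γ, 1 is a, then the parameters ρ₁ ++ ρ₂.
  agreeOnSubsets : Class M → Class M → Class M
  agreeOnSubsets (class {n₁} φ₁ ρ₁) (class {n₂} φ₂ ρ₂) =
    class (∀' ((zero ⊆' suc zero) ⇒' (ψ₁ ⇔' ψ₂))) (ρ₁ ++ ρ₂)
    where
      ψ₁ = rename (lift (suc ∘ (_↑ˡ n₂))) φ₁
      ψ₂ = rename (lift (suc ∘ (n₁ ↑ʳ_))) φ₂

  ∈-agreeOnSubsets : (𝒪₁ 𝒪₂ : Class M) →
                     ∀ a → AgreeOnSubsets 𝒪₁ 𝒪₂ a ⇔ a ∈ᶜ agreeOnSubsets 𝒪₁ 𝒪₂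
  ∈-agreeOnSubsets (class {n₁} φ₁ ρ₁) (class {n₂} φ₂ ρ₂) a =
    ⇔-sym (Π-cong-⇔ λ γ → →-cong-⇔ (⇔-id _) (⟦⇔'⟧ (rename _ φ₁) (rename _ φ₂) (ψ₁⇔ γ) (ψ₂⇔ γ)))
    where
      ψ₁⇔ : ∀ γ → ⟦ rename (lift (suc ∘ (_↑ˡ n₂))) φ₁ ⟧ (γ ∷ a ∷ ρ₁ ++ ρ₂) ⇔ ⟦ φ₁ ⟧ (γ ∷ ρ₁)
      ψ₁⇔ γ = ⟦rename⟧ _ φ₁ (lift-≗ (lookup-++ˡ ρ₁ ρ₂) γ)
      ψ₂⇔ : ∀ γ → ⟦ rename (lift (suc ∘ (n₁ ↑ʳ_))) φ₂ ⟧ (γ ∷ a ∷ ρ₁ ++ ρ₂) ⇔ ⟦ φ₂ ⟧ (γ ∷ ρ₂)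
      ψ₂⇔ γ = ⟦rename⟧ _ φ₂ (lift-≗ (lookup-++ʳ ρ₁ ρ₂) γ)

  ⊆-refl : ∀ {a} → a ⊆ a
  ⊆-refl _ x∈a = x∈a

  AgreeOnSubsets-sym : ∀ {𝒪₁ 𝒪₂ a} → AgreeOnSubsets 𝒪₁ 𝒪₂ a → AgreeOnSubsets 𝒪₂ 𝒪₁ a
  AgreeOnSubsets-sym agree γ γ⊆a = ⇔-sym (agree γ γ⊆a)

  plump-transfer : ∀ {𝒪₁ 𝒪₂ a γ} → IsPlumpClass M 𝒪₁ → IsPlumpClass M 𝒪₂ →
                   (∀ β → β ∈ a → AgreeOnSubsets 𝒪₁ 𝒪₂ β) → γ ⊆ a → γ ∈ᶜ 𝒪₁ → γ ∈ᶜ 𝒪₂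
  plump-transfer {𝒪₁} {𝒪₂} {γ = γ} (ord₁ , plump₁) (_ , plump₂) agree γ⊆a γ∈𝒪₁ =
    proj₂ (plump₂ γ γ-ord) (elements-in-𝒪₂ , plump-for-𝒪₂)
    where
      γ-ord : IsOrd γ
      γ-ord = ord₁ γ γ∈𝒪₁
      γ-plump₁ : (∀ x → x ∈ γ → x ∈ᶜ 𝒪₁) × (∀ β → β ∈ γ → ∀ δ → δ ⊆ β → δ ∈ᶜ 𝒪₁ → δ ∈ γ)
      γ-plump₁ = proj₁ (plump₁ γ γ-ord) γ∈𝒪₁

      elements-in-𝒪₂ : ∀ x → x ∈ γ → x ∈ᶜ 𝒪₂
      elements-in-𝒪₂ x x∈γ = to (agree x (γ⊆a x x∈γ) x ⊆-refl) (proj₁ γ-plump₁ x x∈γ)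

      plump-for-𝒪₂ : ∀ β → β ∈ γ → ∀ δ → δ ⊆ β → δ ∈ᶜ 𝒪₂ → δ ∈ γ
      plump-for-𝒪₂ β β∈γ δ δ⊆β δ∈𝒪₂ =
        proj₂ γ-plump₁ β β∈γ δ δ⊆β (from (agree β (γ⊆a β β∈γ) δ δ⊆β) δ∈𝒪₂)

  AgreeOnSubsets-step : ∀ {𝒪₁ 𝒪₂} → IsPlumpClass M 𝒪₁ → IsPlumpClass M 𝒪₂ →
                        ∀ a → (∀ β → β ∈ a → AgreeOnSubsets 𝒪₁ 𝒪₂ β) → AgreeOnSubsets 𝒪₁ 𝒪₂ a
  AgreeOnSubsets-step {𝒪₁} {𝒪₂} plump₁ plump₂ a agree γ γ⊆a = mk⇔
    (plump-transfer {𝒪₁} {𝒪₂} plump₁ plump₂ agree γ⊆a)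
    (plump-transfer {𝒪₂} {𝒪₁} plump₂ plump₁ agree′ γ⊆a)
    where
      agree′ : ∀ β → β ∈ a → AgreeOnSubsets 𝒪₂ 𝒪₁ β
      agree′ β β∈a = AgreeOnSubsets-sym {𝒪₁} {𝒪₂} (agree β β∈a)

proposition1p1 : ∀ {ℓ : Level} (M : IKP ℓ) (𝒪₁ 𝒪₂ : Class M) →
    IsPlumpClass M 𝒪₁ → IsPlumpClass M 𝒪₂ →
    ∀ α → (_∈Cl_ M α 𝒪₁ → _∈Cl_ M α 𝒪₂) × (_∈Cl_ M α 𝒪₂ → _∈Cl_ M α 𝒪₁)
proposition1p1 M 𝒪₁ 𝒪₂ plump₁ plump₂ α = to agree , from agree
  where
    agree : _∈Cl_ M α 𝒪₁ ⇔ _∈Cl_ M α 𝒪₂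
    agree = definable-induction M (agreeOnSubsets M 𝒪₁ 𝒪₂) (∈-agreeOnSubsets M 𝒪₁ 𝒪₂)
              (AgreeOnSubsets-step M {𝒪₁} {𝒪₂} plump₁ plump₂) α α (⊆-refl M)
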